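{- Let $n\ge 1$ and let $H=\{(i,i): 1\le i\le n\}\cup\{(i,n+1-i): 1\le i\le n\}\subseteq\{1,\dots,n\}^2$ (the $X$-shaped board formed by the two diagonals of the $n\times n$ grid). Equip $H$ with one switch for each of the $n$ rows and one for each of the $n$ columns. Then the maximum discrepancy of $H$ is $F(H)=n$.
   Context: Switching game on a board $H\subseteq\{1,\dots,n\}^2$ with one switch per row $i$ and per column $j$: an initial configuration is an assignment $a_{ij}\in\{ -1,+1\}$ to each $(i,j)\in H$; a switch setting is a choice of $x_i\in\{ -1,+1\}$ for each row and $y_j\in\{ -1,+1\}$ for each column. The signed discrepancy is $\sum_{(i,j)\in H} a_{ij}x_iy_j$, and the maximum discrepancy is $F(H)=\min_{(a_{ij})}\max_{(x_i),(y_j)}\sum_{(i,j)\in H}a_{ij}x_iy_j$, the minimum over all initial configurations of the best achievable signed discrepancy. -}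

module Defs where

open import Data.Nat using (ℕ; zero; suc; _∸_)
import Data.Nat as ℕ
open import Data.Fin using (Fin; toℕ)
open import Data.Integer using (ℤ; +_; _+_; _*_; -[1+_])
open import Data.Bool using (Bool; true; false; _∨_; if_then_else_)
open import Data.Fin using (_≟_)
open import Relation.Nullary.Decidable using (⌊_⌋)
import Data.Nat.Properties as ℕP

data Sign : Set where
  plus minus : Sign

⟦_⟧ : Sign → ℤ
⟦ plus ⟧  = + 1
⟦ minus ⟧ = -[1+ 0 ]

∑ : (n : ℕ) → (Fin n → ℤ) → ℤ
∑ zero    f = + 0
∑ (suc n) f = f Fin.zero + ∑ n (λ i → f (Fin.suc i))
  where import Data.Fin as Fin

-- The X-shaped board on {0..n-1}², 0-indexed: (i,i) and (i, n-1-i).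
-- Cells are a set: the centre cell (odd n) belongs to H once.
inX : (n : ℕ) → Fin n → Fin n → Bool
inX n i j = ⌊ i ≟ j ⌋ ∨ ⌊ toℕ j ℕP.≟ (n ∸ 1 ∸ toℕ i) ⌋

disc : (n : ℕ) → (Fin n → Fin n → Bool) → (Fin n → Fin n → Sign)
     → (Fin n → Sign) → (Fin n → Sign) → ℤ
disc n H a x y =
  ∑ n (λ i → ∑ n (λ j →
    if H i j then ⟦ a i j ⟧ * ⟦ x i ⟧ * ⟦ y j ⟧ else + 0))

-- F(H) = min_a max_{x,y} disc  equals m, unfolded for finite sets:
-- some configuration a has max ≤ m, and every configuration has max ≥ m
-- (max and min are attained since everything is finite).
MaxDiscrepancyIs : (n : ℕ) → (Fin n → Fin n → Bool) → ℤ → Set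
MaxDiscrepancyIs n H m =
  (Σ (Fin n → Fin n → Sign) λ a →
     ∀ x y → disc n H a x y Data.Integer.≤ m)
  × (∀ a → Σ (Fin n → Sign) λ x → Σ (Fin n → Sign) λ y →
       m Data.Integer.≤ disc n H a x y)
  where open import Data.Product using (Σ; _×_)
        import Data.Integer

-- Row i of the X board meets only the columns i and ī = n−1−i, so the discrepancy is
-- the sum over rows of x_i (a_ii y_i + a_iī y_ī), with a single term on the centre row.
-- Let w_i be +1, 0 or −1 according as row i lies above, at or below the centre; w is
-- antisymmetric under i ↦ ī, hence Σ w_i = 0 and Σ w_i y_i y_ī = 0.
-- Upper bound: put −1 exactly on the cells strictly below the main diagonal.  A row
-- then contributes at most |y_i + w_i y_ī| = 1 + w_i y_i y_ī, and summing gives n.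
-- Lower bound: given a, let y = +1 on the upper half, choose y_ī so that both cells of
-- an upper row i agree, and put x_i = a_ii y_i.  Every diagonal cell is then +1, so a
-- row contributes at least 1 + w_i, and summing gives n.
module Submission where

open import Defs
open import Data.Nat using (ℕ; _≥_)
open import Data.Integer using (+_)

import Data.Nat as ℕ
open import Data.Nat using (zero; suc)
open import Data.Nat.Properties using (∸-+-assoc)
open import Data.Bool using (Bool; true; false; if_then_else_; _∨_)
open import Data.Bool.Properties using (∨-identityʳ)
open import Data.Fin using (Fin; zero; suc; toℕ; opposite; _≟_; _<_; _<?_)
open import Data.Fin.Properties
  using (toℕ-injective; opposite-prop; opposite-involutive; <-cmp; <⇒≢; <-irrefl)
import Data.Fin.Permutation as Perm
open import Data.Integer using (ℤ; -[1+_]; -_; _+_; _-_; _*_; _≤_; _≤?_; -1ℤ)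
open import Data.Integer.Properties
  using ( +-*-semiring; ≤-refl; +-mono-≤; +-identityˡ; +-identityʳ; +-comm; *-comm
        ; -1*i≡-i; neg-distribˡ-*; module ≤-Reasoning)
open import Data.Product using (_,_)
open import Function using (_∘_)
open import Relation.Binary.Definitions using (tri<; tri≈; tri>)
open import Relation.Binary.PropositionalEquality
open import Relation.Nullary using (Dec; yes; no; does)
open import Relation.Nullary.Decidable
  using (isYes≗does; toWitness; dec-true; dec-false; does-≡; map′)
open import Algebra.Properties.Semiring.Sum +-*-semiring
  using (sum; sum-cong-≗; sum-replicate-zero; ∑-distrib-+; ∑-permute; *-distribˡ-sum)

∑≡sum : ∀ n (f : Fin n → ℤ) → ∑ n f ≡ sum f
∑≡sum zero    f = refl
∑≡sum (suc n) f = cong (_+_ (f zero)) (∑≡sum n (f ∘ suc))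

sum-mono-≤ : ∀ {n} {f g : Fin n → ℤ} → (∀ i → f i ≤ g i) → sum f ≤ sum g
sum-mono-≤ {zero}  _   = ≤-refl
sum-mono-≤ {suc n} f≤g = +-mono-≤ (f≤g zero) (sum-mono-≤ (f≤g ∘ suc))

sum-ones : ∀ n → sum {n} (λ _ → + 1) ≡ + n
sum-ones zero    = refl
sum-ones (suc n) = cong (_+_ (+ 1)) (sum-ones n)

i≡-i⇒i≡0 : ∀ {i : ℤ} → i ≡ - i → i ≡ + 0
i≡-i⇒i≡0 {+ zero}   _  = refl
i≡-i⇒i≡0 {+ suc _}  ()
i≡-i⇒i≡0 { -[1+ _ ]} ()

sum-antisymmetric : ∀ {n} (h : Fin n → ℤ) → (∀ i → h (opposite i) ≡ - h i) → sum h ≡ + 0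
sum-antisymmetric h anti = i≡-i⇒i≡0 (begin
  sum h                 ≡⟨ ∑-permute h Perm.reverse ⟩
  sum (h ∘ opposite)    ≡⟨ sum-cong-≗ (λ i → trans (anti i) (sym (-1*i≡-i (h i)))) ⟩
  sum (λ i → -1ℤ * h i) ≡⟨ *-distribˡ-sum -1ℤ h ⟨
  -1ℤ * sum h           ≡⟨ -1*i≡-i (sum h) ⟩
  - sum h               ∎)
  where open ≡-Reasoning

sum-one-point : ∀ {n} (p : Fin n) (g : Fin n → ℤ) →
                sum {n} (λ j → if does (p ≟ j) then g j else + 0) ≡ g p
sum-one-point {suc n} zero    g =
  trans (cong (_+_ (g zero)) (sum-replicate-zero n)) (+-identityʳ (g zero))
sum-one-point {suc n} (suc p) g =
  trans (+-identityˡ (sum (λ j → if does (p ≟ j) then g (suc j) else + 0)))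
        (sum-one-point p (λ j → g (suc j)))

sum-two-points : ∀ {n} (p q : Fin n) (g : Fin n → ℤ) →
                 sum {n} (λ j → if does (p ≟ j) ∨ does (q ≟ j) then g j else + 0)
                 ≡ (if does (p ≟ q) then g p else g p + g q)
sum-two-points {suc n} zero    zero    g = sum-one-point zero g
sum-two-points {suc n} zero    (suc q) g = cong (_+_ (g zero)) (sum-one-point q (λ j → g (suc j)))
sum-two-points {suc n} (suc p) zero    g = begin
  g zero + sum (λ j → if does (p ≟ j) ∨ false then g (suc j) else + 0)
    ≡⟨ cong (_+_ (g zero))
            (trans (sum-cong-≗ λ j → cong (λ b → if b then g (suc j) else + 0) (∨-identityʳ _))
                   (sum-one-point p (λ j → g (suc j)))) ⟩
  g zero + g (suc p) ≡⟨ +-comm (g zero) (g (suc p)) ⟩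
  g (suc p) + g zero ∎
  where open ≡-Reasoning
sum-two-points {suc n} (suc p) (suc q) g =
  trans (+-identityˡ (sum (λ j → if does (p ≟ j) ∨ does (q ≟ j) then g (suc j) else + 0)))
        (sum-two-points p q (λ j → g (suc j)))

toℕ-opposite : ∀ {n} (i : Fin n) → toℕ (opposite i) ≡ n ℕ.∸ 1 ℕ.∸ toℕ i
toℕ-opposite {n} i = trans (opposite-prop i) (sym (∸-+-assoc n 1 (toℕ i)))

-- Stated with does rather than ⌊_⌋: only does computes through the map′ in Fin's _≟_,
-- which the point sums above rely on.
inX≡diagonal∨opposite : ∀ n (i j : Fin n) → inX n i j ≡ does (i ≟ j) ∨ does (opposite i ≟ j)
inX≡diagonal∨opposite n i j =
  cong₂ _∨_ (isYes≗does (i ≟ j))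
            (trans (isYes≗does _) (does-≡ (map′ to from (toℕ j ℕ.≟ n ℕ.∸ 1 ℕ.∸ toℕ i)) (opposite i ≟ j)))
  where
  to : toℕ j ≡ n ℕ.∸ 1 ℕ.∸ toℕ i → opposite i ≡ j
  to e = toℕ-injective (trans (toℕ-opposite i) (sym e))
  from : opposite i ≡ j → toℕ j ≡ n ℕ.∸ 1 ℕ.∸ toℕ i
  from refl = toℕ-opposite i

cell : ∀ {n} → (Fin n → Fin n → Sign) → (Fin n → Sign) → (Fin n → Sign) → Fin n → Fin n → ℤ
cell a x y i j = ⟦ a i j ⟧ * ⟦ x i ⟧ * ⟦ y j ⟧

rowValue : ∀ {n} → (Fin n → Fin n → Sign) → (Fin n → Sign) → (Fin n → Sign) → Fin n → ℤ
rowValue a x y i = if does (i ≟ opposite i) then cell a x y i i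
                   else cell a x y i i + cell a x y i (opposite i)

disc-inX≡sum-rowValue : ∀ n a x y → disc n (inX n) a x y ≡ sum (rowValue a x y)
disc-inX≡sum-rowValue n a x y = trans (∑≡sum n _) (sum-cong-≗ row)
  where
  open ≡-Reasoning
  row : ∀ i → ∑ n (λ j → if inX n i j then cell a x y i j else + 0) ≡ rowValue a x y i
  row i = begin
    ∑ n (λ j → if inX n i j then cell a x y i j else + 0)
      ≡⟨ ∑≡sum n _ ⟩
    sum (λ j → if inX n i j then cell a x y i j else + 0)
      ≡⟨ sum-cong-≗ (λ j → cong (λ b → if b then cell a x y i j else + 0) (inX≡diagonal∨opposite n i j)) ⟩
    sum (λ j → if does (i ≟ j) ∨ does (opposite i ≟ j) then cell a x y i j else + 0)
      ≡⟨ sum-two-points i (opposite i) (cell a x y i) ⟩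
    rowValue a x y i ∎

_·_ : Sign → Sign → Sign
plus  · s     = s
minus · plus  = minus
minus · minus = plus

∀-sign? : {P : Sign → Set} → (∀ s → Dec (P s)) → Dec (∀ s → P s)
∀-sign? P? with P? plus | P? minus
... | yes p | yes m = yes λ { plus → p ; minus → m }
... | no ¬p | _     = no λ ∀P → ¬p (∀P plus)
... | yes _ | no ¬m = no λ ∀P → ¬m (∀P minus)

switched-pair-≤ : ∀ e x u v →
  ⟦ plus ⟧ * ⟦ x ⟧ * ⟦ u ⟧ + ⟦ e ⟧ * ⟦ x ⟧ * ⟦ v ⟧ ≤ + 1 + ⟦ e ⟧ * (⟦ u ⟧ * ⟦ v ⟧)
switched-pair-≤ =
  toWitness {a? = ∀-sign? λ e → ∀-sign? λ x → ∀-sign? λ u → ∀-sign? λ v → _ ≤? _} _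

switched-single-≤ : ∀ x u → ⟦ plus ⟧ * ⟦ x ⟧ * ⟦ u ⟧ ≤ + 1
switched-single-≤ = toWitness {a? = ∀-sign? λ x → ∀-sign? λ u → _ ≤? _} _

aligned-pair-≥ : ∀ a b →
  + 1 + + 1 ≤ ⟦ a ⟧ * ⟦ a · plus ⟧ * ⟦ plus ⟧ + ⟦ b ⟧ * ⟦ a · plus ⟧ * ⟦ a · b ⟧
aligned-pair-≥ = toWitness {a? = ∀-sign? λ a → ∀-sign? λ b → _ ≤? _} _

diagonal-aligned-pair-≥ : ∀ a b u v →
  + 1 + ⟦ minus ⟧ ≤ ⟦ a ⟧ * ⟦ a · u ⟧ * ⟦ u ⟧ + ⟦ b ⟧ * ⟦ a · u ⟧ * ⟦ v ⟧
diagonal-aligned-pair-≥ =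
  toWitness {a? = ∀-sign? λ a → ∀-sign? λ b → ∀-sign? λ u → ∀-sign? λ v → _ ≤? _} _

diagonal-aligned-single-≥ : ∀ a u → + 1 + + 0 ≤ ⟦ a ⟧ * ⟦ a · u ⟧ * ⟦ u ⟧
diagonal-aligned-single-≥ = toWitness {a? = ∀-sign? λ a → ∀-sign? λ u → _ ≤? _} _

iverson : Bool → ℤ
iverson true  = + 1
iverson false = + 0

iverson-swap : ∀ b c → iverson c - iverson b ≡ - (iverson b - iverson c)
iverson-swap true  true  = refl
iverson-swap true  false = refl
iverson-swap false true  = refl
iverson-swap false false = refl

above below : ∀ {n} → Fin n → Bool
above i = does (i <? opposite i)
below i = does (opposite i <? i)

weight : ∀ {n} → Fin n → ℤ
weight i = iverson (above i) - iverson (below i)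

weight-opposite : ∀ {n} (i : Fin n) → weight (opposite i) ≡ - weight i
weight-opposite i = begin
  weight (opposite i)
    ≡⟨ cong (λ k → iverson (does (opposite i <? k)) - iverson (does (k <? opposite i)))
            (opposite-involutive i) ⟩
  iverson (below i) - iverson (above i)
    ≡⟨ iverson-swap (above i) (below i) ⟩
  - weight i ∎
  where open ≡-Reasoning

minimizingConfig : ∀ {n} → Fin n → Fin n → Sign
minimizingConfig i j = if does (j <? i) then minus else plus

rowValue-minimizingConfig-≤ : ∀ {n} (x y : Fin n → Sign) i →
  rowValue minimizingConfig x y i ≤ + 1 + weight i * (⟦ y i ⟧ * ⟦ y (opposite i) ⟧)
rowValue-minimizingConfig-≤ x y i
  rewrite dec-false (i <? i) (<-irrefl refl)
  with <-cmp i (opposite i)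
... | tri< i<ī _ ī≮i
  rewrite dec-false (i ≟ opposite i) (<⇒≢ i<ī)
        | dec-true (i <? opposite i) i<ī | dec-false (opposite i <? i) ī≮i
  = switched-pair-≤ plus (x i) (y i) (y (opposite i))
... | tri≈ i≮ī i≡ī ī≮i
  rewrite dec-true (i ≟ opposite i) i≡ī
        | dec-false (i <? opposite i) i≮ī | dec-false (opposite i <? i) ī≮i
  = switched-single-≤ (x i) (y i)
... | tri> i≮ī _ ī<i
  rewrite dec-false (i ≟ opposite i) (<⇒≢ ī<i ∘ sym)
        | dec-false (i <? opposite i) i≮ī | dec-true (opposite i <? i) ī<i
  = switched-pair-≤ minus (x i) (y i) (y (opposite i))

minimizingConfig-disc-≤ : ∀ n (x y : Fin n → Sign) → disc n (inX n) minimizingConfig x y ≤ + n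
minimizingConfig-disc-≤ n x y = begin
  disc n (inX n) minimizingConfig x y              ≡⟨ disc-inX≡sum-rowValue n minimizingConfig x y ⟩
  sum (rowValue minimizingConfig x y)              ≤⟨ sum-mono-≤ (rowValue-minimizingConfig-≤ x y) ⟩
  sum (λ i → + 1 + weight i * w i)                 ≡⟨ ∑-distrib-+ (λ _ → + 1) (λ i → weight i * w i) ⟩
  sum {n} (λ _ → + 1) + sum (λ i → weight i * w i) ≡⟨ cong₂ _+_ (sum-ones n)
                                                                (sum-antisymmetric _ weighted-opposite) ⟩
  + n + + 0                                        ≡⟨ +-identityʳ (+ n) ⟩
  + n                                              ∎
  where
  open ≤-Reasoning
  w : Fin n → ℤ
  w i = ⟦ y i ⟧ * ⟦ y (opposite i) ⟧
  w-opposite : ∀ i → w (opposite i) ≡ w i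
  w-opposite i = trans (cong (λ k → ⟦ y (opposite i) ⟧ * ⟦ y k ⟧) (opposite-involutive i))
                       (*-comm ⟦ y (opposite i) ⟧ ⟦ y i ⟧)
  weighted-opposite : ∀ i → weight (opposite i) * w (opposite i) ≡ - (weight i * w i)
  weighted-opposite i = begin-equality
    weight (opposite i) * w (opposite i) ≡⟨ cong₂ _*_ (weight-opposite i) (w-opposite i) ⟩
    - weight i * w i                     ≡⟨ neg-distribˡ-* (weight i) (w i) ⟨
    - (weight i * w i)                   ∎

-- +1 on the upper half; on a lower column ī it makes the two cells of row i agree.
columnResponse : ∀ {n} → (Fin n → Fin n → Sign) → Fin n → Sign
columnResponse a j = if below j then a (opposite j) (opposite j) · a (opposite j) j else plus

rowResponse : ∀ {n} → (Fin n → Fin n → Sign) → Fin n → Sign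
rowResponse a i = a i i · columnResponse a i

columnResponse-opposite : ∀ {n} (a : Fin n → Fin n → Sign) {i} → i < opposite i →
                          columnResponse a (opposite i) ≡ a i i · a i (opposite i)
columnResponse-opposite a {i} i<ī
  rewrite opposite-involutive i | dec-true (i <? opposite i) i<ī = refl

rowValue-response-≥ : ∀ {n} (a : Fin n → Fin n → Sign) i →
  + 1 + weight i ≤ rowValue a (rowResponse a) (columnResponse a) i
rowValue-response-≥ a i with <-cmp i (opposite i)
... | tri< i<ī _ ī≮i
  rewrite columnResponse-opposite a i<ī | dec-false (i ≟ opposite i) (<⇒≢ i<ī)
        | dec-true (i <? opposite i) i<ī | dec-false (opposite i <? i) ī≮i
  = aligned-pair-≥ (a i i) (a i (opposite i))
... | tri≈ i≮ī i≡ī ī≮i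
  rewrite dec-true (i ≟ opposite i) i≡ī
        | dec-false (i <? opposite i) i≮ī | dec-false (opposite i <? i) ī≮i
  = diagonal-aligned-single-≥ (a i i) plus
... | tri> i≮ī _ ī<i
  rewrite dec-false (i ≟ opposite i) (<⇒≢ ī<i ∘ sym)
        | dec-false (i <? opposite i) i≮ī | dec-true (opposite i <? i) ī<i
  = diagonal-aligned-pair-≥ (a i i) (a i (opposite i))
      (a (opposite i) (opposite i) · a (opposite i) i) (columnResponse a (opposite i))

response-disc-≥ : ∀ n (a : Fin n → Fin n → Sign) →
                  + n ≤ disc n (inX n) a (rowResponse a) (columnResponse a)
response-disc-≥ n a = begin
  + n                                    ≡⟨ +-identityʳ (+ n) ⟨
  + n + + 0                              ≡⟨ cong₂ _+_ (sum-ones n)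
                                                      (sum-antisymmetric (weight {n}) weight-opposite) ⟨
  sum {n} (λ _ → + 1) + sum (weight {n}) ≡⟨ ∑-distrib-+ (λ _ → + 1) (weight {n}) ⟨
  sum {n} (λ i → + 1 + weight i)         ≤⟨ sum-mono-≤ (rowValue-response-≥ a) ⟩
  sum (rowValue a (rowResponse a) (columnResponse a))
    ≡⟨ disc-inX≡sum-rowValue n a (rowResponse a) (columnResponse a) ⟨
  disc n (inX n) a (rowResponse a) (columnResponse a) ∎
  where open ≤-Reasoning

proposition1 : (n : ℕ) → n ≥ 1 → MaxDiscrepancyIs n (inX n) (+ n)
proposition1 n _ =
  (minimizingConfig , minimizingConfig-disc-≤ n) ,
  λ a → rowResponse a , columnResponse a , response-disc-≥ n a
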